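{- Let $K$ be a simplicial complex on $[m]$ and $K_i$ a simplicial complex on $[l_i]$ for $i\in[m]$. Let $A\in K(K_1,\ldots,K_m)$, $A=A_1\sqcup\cdots\sqcup A_m$ with $A_i\subseteq[l_i]$, let $J=\{i\in[m]\mid A_i\notin K_i\}$ (so $J\in K$), and write $[m]\setminus J=\{i_1,\ldots,i_k\}$. For each $i\in J$ put $M_i=[l_i]\setminus A_i$ and let $\Delta_{M_i}$ be the full simplex on $M_i$. Then $$\mathrm{link}_{K(K_1,\ldots,K_m)}A=\mathrm{link}_K J\big(\mathrm{link}_{K_{i_1}}A_{i_1},\ldots,\mathrm{link}_{K_{i_k}}A_{i_k}\big)\ast\Big(\mathop{\ast}_{i\in J}\Delta_{M_i}\Big),$$ as simplicial complexes on $\bigsqcup_{i=1}^m([l_i]\setminus A_i)$.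
   Context: A simplicial complex on a finite set $V$ is a family of subsets of $V$ closed under taking subsets (ghost vertices allowed). For $I\in K$, $\mathrm{link}_K I$ is the complex on $V\setminus I$ with $J\in\mathrm{link}_K I$ iff $J\sqcup I\in K$ (so $\mathrm{link}_K J$ above is a complex on $\{i_1,\ldots,i_k\}$, and $\mathrm{link}_{K_i}A_i$ a complex on $[l_i]\setminus A_i$). The join $K\ast L$ of complexes on disjoint sets $V,W$ is the complex on $V\sqcup W$ with simplices $I\sqcup J$, $I\in K$, $J\in L$. The full simplex $\Delta_M$ on $M$ consists of all subsets of $M$. For $K$ on a set $\{1,\ldots,k\}$ (or any ordered finite set) and $K_i$ on $[l_i]$, the composition $K(K_1,\ldots,K_k)$ is the simplicial complex on $\bigsqcup_i[l_i]$ in which $I=\bigsqcup_i I_i$ ($I_i\subseteq[l_i]$) is a simplex iff $\{i\mid I_i\notin K_i\}\in K$. -}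

module Defs where

open import Data.Nat using (ℕ; zero; suc)
open import Data.Bool using (Bool; true; false; _∧_; _∨_; not)
open import Data.Fin using (Fin; zero; suc)
open import Data.Product using (Σ; _×_; _,_)
open import Relation.Binary.PropositionalEquality using (_≡_)
open import Function.Bundles using (_⇔_)

Sub : Set → Set
Sub V = V → Bool

module _ {V : Set} where
  _⊆_ : Sub V → Sub V → Set
  I ⊆ J = ∀ x → I x ≡ true → J x ≡ true

  _∪_ : Sub V → Sub V → Sub V
  (I ∪ J) x = I x ∨ J x

  _∩_ : Sub V → Sub V → Sub V
  (I ∩ J) x = I x ∧ J x

  _∖_ : Sub V → Sub V → Sub V
  (I ∖ J) x = I x ∧ not (J x)

  full : Sub V
  full _ = true

-- A (candidate) simplicial complex whose vertex set is a subset 'vert' of V.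
-- Its simplices are the I ⊆ vert with simp I ≡ true (see _∈ₛ_).
record Cx (V : Set) : Set where
  field
    vert : Sub V
    simp : Sub V → Bool
open Cx public

module _ {V : Set} where
  _∈ₛ_ : Sub V → Cx V → Set
  I ∈ₛ K = (I ⊆ vert K) × (simp K I ≡ true)

  IsSimplicialComplex : Cx V → Set
  IsSimplicialComplex K = ∀ I J → J ⊆ I → I ∈ₛ K → J ∈ₛ K

  _≅_ : Cx V → Cx V → Set
  K ≅ L = (∀ v → vert K v ≡ vert L v) × (∀ I → (I ∈ₛ K) ⇔ (I ∈ₛ L))

  link : Cx V → Sub V → Cx V
  vert (link K A) = vert K ∖ A
  simp (link K A) I = simp K (I ∪ A)

  Δ : Sub V → Cx V
  vert (Δ M) = M
  simp (Δ M) _ = true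

  -- join of complexes on disjoint vertex sets (inside the same ambient V)
  join : Cx V → Cx V → Cx V
  vert (join K L) = vert K ∪ vert L
  simp (join K L) I = simp K (I ∩ vert K) ∧ simp L (I ∩ vert L)

slice : {V : Set} {L : V → Set} → Sub (Σ V L) → (v : V) → Sub (L v)
slice I v x = I (v , x)

comp : {V : Set} {L : V → Set} → Cx V → ((v : V) → Cx (L v)) → Cx (Σ V L)
vert (comp K Ks) (v , x) = vert K v ∧ vert (Ks v) x
simp (comp K Ks) I = simp K (λ v → vert K v ∧ not (simp (Ks v) (slice I v)))

allᵇ : {m : ℕ} → (Fin m → Bool) → Bool
allᵇ {zero} f = true
allᵇ {suc m} f = f zero ∧ allᵇ (λ i → f (suc i))

bigJoin : {m : ℕ} {L : Fin m → Set} → Sub (Fin m) → ((i : Fin m) → Cx (L i)) → Cx (Σ (Fin m) L)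
vert (bigJoin W Ks) (i , x) = W i ∧ vert (Ks i) x
simp (bigJoin W Ks) I = allᵇ (λ i → not (W i) ∨ simp (Ks i) (slice I i))

-- J = { i ∈ [m] | A_i ∉ K_i }  (vertex sets of the K_i being all of [l_i])
indexJ : {m : ℕ} {L : Fin m → Set} → ((i : Fin m) → Cx (L i)) → Sub (Σ (Fin m) L) → Sub (Fin m)
indexJ Ks A i = not (simp (Ks i) (slice A i))

-- A simplex of the composition is tested only through the set of indices i with
-- I_i ∉ K_i.  Passing to the link of A, an index in J stays bad whatever I_i is,
-- because a superset of a non-simplex is a non-simplex; so the J-blocks impose no
-- condition (full simplices), while on the other blocks I_i ⊔ A_i ∈ K_i says exactly
-- I_i ∈ link A_i, and the bad set of I ⊔ A is that of the smaller composition
-- together with J, which is what link_K J records.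
module Submission where

open import Data.Nat using (ℕ)
open import Data.Bool using (Bool; true; false; not; _∧_; _∨_)
open import Data.Bool.Properties
  using (∨-identityʳ; ∨-zeroʳ; ∧-identityʳ; ∨-distribʳ-∧; ∨-inverseˡ)
open import Data.Fin using (Fin; zero; suc)
open import Data.Product using (Σ; _,_; proj₁)
open import Relation.Binary.PropositionalEquality
  using (_≡_; refl; sym; trans; cong; cong₂; module ≡-Reasoning)
open import Function.Bundles using (mk⇔)
open import Defs

≡-from-⇔-true : ∀ {b c : Bool} → (b ≡ true → c ≡ true) → (c ≡ true → b ≡ true) → b ≡ c
≡-from-⇔-true {false} {false} _ _ = refl
≡-from-⇔-true {false} {true}  _ g = g refl
≡-from-⇔-true {true}  {false} f _ = sym (f refl)
≡-from-⇔-true {true}  {true}  _ _ = refl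

allᵇ-true : ∀ {m} (f : Fin m → Bool) → (∀ i → f i ≡ true) → allᵇ f ≡ true
allᵇ-true {ℕ.zero}  f _    = refl
allᵇ-true {ℕ.suc m} f f≡t =
  cong₂ _∧_ (f≡t zero) (allᵇ-true (λ i → f (suc i)) (λ i → f≡t (suc i)))

module _ {V : Set} where

  ≅-from-≡ : {K L : Cx V} → (∀ v → vert K v ≡ vert L v) → (∀ I → simp K I ≡ simp L I) →
             K ≅ L
  ≅-from-≡ vert≡ simp≡ = vert≡ , λ I → mk⇔
    (λ { (I⊆K , I∈K) → (λ v p → trans (sym (vert≡ v)) (I⊆K v p)) , trans (sym (simp≡ I)) I∈K })
    (λ { (I⊆L , I∈L) → (λ v p → trans (vert≡ v) (I⊆L v p)) , trans (simp≡ I) I∈L })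

  module _ (K : Cx V) (closed : IsSimplicialComplex K) (full-vert : ∀ v → vert K v ≡ true) where

    simp-antitone : ∀ {X Y} → Y ⊆ X → simp K X ≡ true → simp K Y ≡ true
    simp-antitone {X} {Y} Y⊆X X∈K with closed X Y Y⊆X ((λ v _ → full-vert v) , X∈K)
    ... | _ , Y∈K = Y∈K

    simp-upward-false : ∀ {X Y} → Y ⊆ X → simp K Y ≡ false → simp K X ≡ false
    simp-upward-false {X} Y⊆X Y∉K with simp K X in X∈K
    ... | false = refl
    ... | true  = trans (sym (simp-antitone Y⊆X X∈K)) Y∉K

    simp-cong : ∀ {X Y} → (∀ v → X v ≡ Y v) → simp K X ≡ simp K Y
    simp-cong X≐Y = ≡-from-⇔-true
      (simp-antitone (λ v Yv → trans (X≐Y v) Yv))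
      (simp-antitone (λ v Xv → trans (sym (X≐Y v)) Xv))

    simp-link-restrict : ∀ I A → simp K ((I ∩ (vert K ∖ A)) ∪ A) ≡ simp K (I ∪ A)
    simp-link-restrict I A = simp-cong λ v → begin
      (I v ∧ (vert K v ∧ not (A v))) ∨ A v  ≡⟨ cong (λ b → (I v ∧ (b ∧ not (A v))) ∨ A v) (full-vert v) ⟩
      (I v ∧ not (A v)) ∨ A v               ≡⟨ ∨-distribʳ-∧ (A v) (I v) (not (A v)) ⟩
      (I v ∨ A v) ∧ (not (A v) ∨ A v)       ≡⟨ cong ((I v ∨ A v) ∧_) (∨-inverseˡ (A v)) ⟩
      (I v ∨ A v) ∧ true                    ≡⟨ ∧-identityʳ (I v ∨ A v) ⟩
      I v ∨ A v                             ∎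
      where open ≡-Reasoning

  ∪-upperʳ : (I A : Sub V) → A ⊆ (I ∪ A)
  ∪-upperʳ I A v Av = trans (cong (I v ∨_) Av) (∨-zeroʳ (I v))

  simp-join-coneʳ : (K L : Cx V) → (∀ X → simp L X ≡ true) →
                    ∀ I → simp (join K L) I ≡ simp K (I ∩ vert K)
  simp-join-coneʳ K L L-full I =
    trans (cong (simp K (I ∩ vert K) ∧_) (L-full (I ∩ vert L))) (∧-identityʳ _)

simp-bigJoin-Δ : ∀ {m} {L : Fin m → Set} (W : Sub (Fin m)) (M : (i : Fin m) → Sub (L i)) →
                 ∀ I → simp (bigJoin W (λ i → Δ (M i))) I ≡ true
simp-bigJoin-Δ W M I = allᵇ-true _ (λ i → ∨-zeroʳ (not (W i)))

defects : {V : Set} {L : V → Set} → Cx V → ((v : V) → Cx (L v)) → Sub (Σ V L) → Sub V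
defects K Ks I v = vert K v ∧ not (simp (Ks v) (slice I v))

module LinkOfComposition
  {V : Set} {L : V → Set} (K : Cx V) (Ks : (v : V) → Cx (L v))
  (K-closed : IsSimplicialComplex K) (K-full : ∀ v → vert K v ≡ true)
  (Ks-closed : ∀ v → IsSimplicialComplex (Ks v)) (Ks-full : ∀ v x → vert (Ks v) x ≡ true)
  (A : Sub (Σ V L))
  where

  J : Sub V
  J v = not (simp (Ks v) (slice A v))

  linked : Cx (Σ V L)
  linked = comp (link K J) (λ v → link (Ks v) (slice A v))

  vert-link-comp : ∀ p → vert (link (comp K Ks) A) p ≡ vert linked p ∨ (J (proj₁ p) ∧ not (A p))
  vert-link-comp (v , x) rewrite K-full v | Ks-full v x with J v | A (v , x)
  ... | true  | _     = refl
  ... | false | true  = refl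
  ... | false | false = refl

  defects-link : ∀ I v → defects K Ks (I ∪ A) v
                       ≡ defects (link K J) (λ w → link (Ks w) (slice A w)) (I ∩ vert linked) v ∨ J v
  defects-link I v rewrite K-full v with simp (Ks v) (slice A v) in A∈Ks
  ... | false = cong not (simp-upward-false (Ks v) (Ks-closed v) (Ks-full v)
                                            (∪-upperʳ (slice I v) (slice A v)) A∈Ks)
  ... | true = begin
    not (simp (Ks v) (Iᵥ ∪ Aᵥ))                                ≡⟨ cong not (sym (simp-link-restrict (Ks v) (Ks-closed v) (Ks-full v) Iᵥ Aᵥ)) ⟩
    not (simp (Ks v) ((Iᵥ ∩ (vert (Ks v) ∖ Aᵥ)) ∪ Aᵥ))          ≡⟨ sym (∨-identityʳ _) ⟩
    not (simp (Ks v) ((Iᵥ ∩ (vert (Ks v) ∖ Aᵥ)) ∪ Aᵥ)) ∨ false  ∎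
    where
    open ≡-Reasoning
    Iᵥ Aᵥ : Sub (L v)
    Iᵥ = slice I v
    Aᵥ = slice A v

  simp-link-comp : ∀ I → simp (link (comp K Ks) A) I ≡ simp linked (I ∩ vert linked)
  simp-link-comp I = simp-cong K K-closed K-full (defects-link I)

-- The identity holds for every A, so A ∈ₛ comp K Ks is unused (for J ∉ K both sides
-- have no simplices).
mainTheorem10 : (m : ℕ) (l : Fin m → ℕ)
    (K : Cx (Fin m)) (Ks : (i : Fin m) → Cx (Fin (l i))) →
    IsSimplicialComplex K → (∀ i → vert K i ≡ true) →
    (∀ i → IsSimplicialComplex (Ks i)) → (∀ i x → vert (Ks i) x ≡ true) →
    (A : Sub (Σ (Fin m) (λ i → Fin (l i)))) →
    A ∈ₛ comp K Ks →
    link (comp K Ks) A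
      ≅ join (comp (link K (indexJ Ks A)) (λ i → link (Ks i) (slice A i)))
             (bigJoin (indexJ Ks A) (λ i → Δ (full ∖ slice A i)))
mainTheorem10 m l K Ks K-closed K-full Ks-closed Ks-full A _ =
  ≅-from-≡ vert-link-comp λ I →
    trans (simp-link-comp I)
          (sym (simp-join-coneʳ linked cones (simp-bigJoin-Δ J (λ i → full ∖ slice A i)) I))
  where
  open LinkOfComposition K Ks K-closed K-full Ks-closed Ks-full A
  cones : Cx (Σ (Fin m) (λ i → Fin (l i)))
  cones = bigJoin J (λ i → Δ (full ∖ slice A i))
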